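{- Let $G$ be a connected bipartite graph and let $G^*$ be the bridge-block tree of $G$. If $\Delta(G^*)\leq 2$, then $pc(G)=2$.
   Context: All graphs are finite, simple and undirected; $\Delta(H)$ denotes the maximum degree of a graph $H$. Bridge-block tree: let $B$ be the set of cut-edges (bridges) of $G$ and let $\mathcal{D}$ be the set of connected components of $(V(G),E(G)\setminus B)$ (each is either a single vertex or a connected bridgeless subgraph); $G^*$ is the graph obtained from $G$ by contracting each element of $\mathcal{D}$ to a single vertex (so its edges correspond to the bridges of $G$). An edge-coloring of $G$ assigns colors to edges, adjacent edges being allowed the same color. A path is proper if no two adjacent edges of the path have the same color. An edge-coloring of a connected graph $G$ is a proper connection coloring if every pair of distinct vertices of $G$ is joined by a proper path. The proper connection number $pc(G)$ of a connected graph $G$ is the minimum number of colors in a proper connection coloring of $G$. -}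

module Defs where

open import Data.Nat using (ℕ; _<_)
open import Data.Fin using (Fin)
import Data.Fin as F
open import Data.Bool using (Bool; T)
open import Data.List using (List; []; _∷_; head; last)
open import Data.Maybe using (just)
open import Data.List.Relation.Unary.Unique.Propositional using (Unique)
open import Data.Product using (Σ; _×_; _,_; ∃)
open import Data.Sum using (_⊎_)
open import Data.Unit using (⊤)
open import Data.Empty using (⊥)
open import Relation.Nullary using (¬_)
open import Relation.Binary.PropositionalEquality using (_≡_; _≢_)
open import Relation.Binary.Construct.Closure.ReflexiveTransitive using (Star)

record Graph (n : ℕ) : Set where
  field
    adj   : Fin n → Fin n → Bool
    sym   : ∀ u v → adj u v ≡ adj v u
    irrefl : ∀ u → adj u u ≡ Data.Bool.false

open Graph public

Adj : ∀ {n} → Graph n → Fin n → Fin n → Set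
Adj G u v = T (adj G u v)

Connected : ∀ {n} → Graph n → Set
Connected {n} G = (u v : Fin n) → Star (Adj G) u v

Complete : ∀ {n} → Graph n → Set
Complete {n} G = (u v : Fin n) → u ≢ v → Adj G u v

Bipartite : ∀ {n} → Graph n → Set
Bipartite {n} G = Σ (Fin n → Bool) λ side → ∀ u v → Adj G u v → side u ≢ side v

SameEdge : ∀ {n} → Fin n → Fin n → Fin n → Fin n → Set
SameEdge a b u v = (a ≡ u × b ≡ v) ⊎ (a ≡ v × b ≡ u)

AdjMinus : ∀ {n} → Graph n → Fin n → Fin n → Fin n → Fin n → Set
AdjMinus G u v a b = Adj G a b × ¬ SameEdge a b u v

Bridge : ∀ {n} → Graph n → Fin n → Fin n → Set
Bridge G u v = Adj G u v × ¬ Star (AdjMinus G u v) u v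

NonBridgeAdj : ∀ {n} → Graph n → Fin n → Fin n → Set
NonBridgeAdj G a b = Adj G a b × ¬ Bridge G a b

-- x and y lie in the same element of 𝒟 (same vertex of G*)
SameBlock : ∀ {n} → Graph n → Fin n → Fin n → Set
SameBlock G = Star (NonBridgeAdj G)

-- A bridge, represented canonically as an ordered pair u < v.
Br : ∀ {n} → Graph n → Set
Br {n} G = Σ (Fin n) λ u → Σ (Fin n) λ v → (u F.< v) × Bridge G u v

brEnds : ∀ {n} (G : Graph n) → Br G → Fin n × Fin n
brEnds G (u , v , _) = u , v

DistinctBr : ∀ {n} (G : Graph n) → Br G → Br G → Set
DistinctBr G e f = brEnds G e ≢ brEnds G f

-- the bridge e is an edge of G* incident with the vertex of G* containing x
IncidentBlock : ∀ {n} (G : Graph n) → Fin n → Br G → Set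
IncidentBlock G x (u , v , _) = SameBlock G x u ⊎ SameBlock G x v

MaxDegBridgeBlockTree≤2 : ∀ {n} → Graph n → Set
MaxDegBridgeBlockTree≤2 {n} G =
  (x : Fin n) (e₁ e₂ e₃ : Br G) →
  DistinctBr G e₁ e₂ → DistinctBr G e₁ e₃ → DistinctBr G e₂ e₃ →
  IncidentBlock G x e₁ → IncidentBlock G x e₂ → IncidentBlock G x e₃ → ⊥

EdgeColoring : ∀ {n} → Graph n → ℕ → Set
EdgeColoring {n} G k = Σ (Fin n → Fin n → Fin k) λ c → ∀ u v → c u v ≡ c v u

IsWalk : ∀ {n} → Graph n → List (Fin n) → Set
IsWalk G [] = ⊤
IsWalk G (x ∷ []) = ⊤
IsWalk G (x ∷ y ∷ r) = Adj G x y × IsWalk G (y ∷ r)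

ProperlyColored : ∀ {n k} → (Fin n → Fin n → Fin k) → List (Fin n) → Set
ProperlyColored c (x ∷ y ∷ z ∷ r) = c x y ≢ c y z × ProperlyColored c (y ∷ z ∷ r)
ProperlyColored c _ = ⊤

ProperPath : ∀ {n k} → Graph n → (Fin n → Fin n → Fin k) → Fin n → Fin n → Set
ProperPath {n} G c u v = Σ (List (Fin n)) λ vs →
  head vs ≡ just u × last vs ≡ just v × Unique vs × IsWalk G vs × ProperlyColored c vs

IsProperConnectionColoring : ∀ {n k} → (G : Graph n) → EdgeColoring G k → Set
IsProperConnectionColoring {n} G (c , _) = (u v : Fin n) → u ≢ v → ProperPath G c u v

HasPCColoring : ∀ {n} → Graph n → ℕ → Set
HasPCColoring G k = Σ (EdgeColoring G k) (IsProperConnectionColoring G)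

PCNumberIs : ∀ {n} → Graph n → ℕ → Set
PCNumberIs G k = HasPCColoring G k × (∀ m → m < k → ¬ HasPCColoring G m)

-- Call a walk in G a tour if it never traverses an edge in both directions.  Given a tour
-- through all vertices, colour each traversed edge uv (oriented along the tour) by the side
-- of u in the bipartition: consecutive steps of the tour, read forwards or backwards, then
-- get different colours, so loop-erasing the segment between two vertices gives a proper
-- path.  A spanning tour is grown one vertex at a time.  A non-bridge edge sw leaving the
-- tour lies on a cycle; the part of the cycle off the tour is an ear that is spliced in,
-- repeating the tour segment between its ends in the same direction.  A bridge leaving the
-- tour must start in the block of an end of the tour, since every other block the tour
-- visits already meets two of its bridges and Δ(G*) ≤ 2; the tour walks back to it inside
-- that block and crosses it.  One colour does not suffice since G has two non-adjacent
-- vertices.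

module Submission where

open import Defs hiding (sym)
open import Level using (0ℓ)
open import Data.Nat using (ℕ; zero; suc; _≤_; _<_; z≤n; s≤s)
open import Data.Nat.Properties using (≤-refl; <-≤-trans; m≤n⇒m≤1+n; ≤-pred)
open import Data.Fin using (Fin; zero; suc)
open import Data.Bool using (Bool; true; false; T; _xor_)
open import Data.Bool.Properties using (T?; not-injective; ¬-not)
open import Data.Fin.Properties using (any?; all?; ¬∀⟶∃¬; <-cmp) renaming (_≟_ to _≟ᶠ_)
open import Data.List using (List; []; _∷_; _++_; [_]; filter; length; allFin; last)
open import Data.Maybe using (just)
open import Data.Maybe.Properties using (just-injective)
open import Data.List.Properties using (++-assoc)
open import Data.List.Membership.Propositional using (_∈_; _∉_)
open import Data.List.Membership.Propositional.Properties using (∈-++⁺ˡ; ∈-++⁺ʳ; ∈-++⁻; ∈-allFin; ∈-map⁺; ∈-map⁻)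
open import Data.List.Relation.Unary.Any using (here; there)
open import Data.List.Relation.Unary.All using ([]; _∷_)
import Data.List.Relation.Unary.All as All
import Data.List.Relation.Unary.All.Properties as All
open import Data.List.Relation.Unary.AllPairs using ([]; _∷_)
open import Data.List.Relation.Unary.Unique.Propositional using (Unique)
open import Data.Product using (Σ; ∃; _×_; _,_; proj₁; proj₂)
open import Data.Product.Properties using (≡-dec)
open import Data.Sum using (_⊎_; inj₁; inj₂; [_,_]′)
open import Data.Empty using (⊥; ⊥-elim)
open import Data.Unit using (tt)
open import Function using (_∘_; id)
open import Relation.Binary using (Rel; Decidable; Sym; tri<; tri≈; tri>)
open import Relation.Nullary using (¬_; Dec; yes; no; contradiction)
open import Relation.Nullary.Decidable using (_×-dec_; _⊎-dec_; _→-dec_; ¬?)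
open import Data.List.Relation.Binary.Subset.Propositional using (_⊆_)
open import Relation.Binary.PropositionalEquality using (_≡_; _≢_; refl; sym; trans; cong; subst; subst₂)
open import Relation.Binary.Construct.Closure.ReflexiveTransitive using (Star; ε; _◅_; _◅◅_)
import Relation.Binary.Construct.Closure.ReflexiveTransitive as Star

module Walks {A : Set} where

  private variable
    R Q : Rel A 0ℓ
    a b x y z p q : A
    vs us : List A

  -- Unlike Star, a walk records the vertices it visits after its first one.
  data Walk (R : Rel A 0ℓ) : A → A → List A → Set where
    []ʷ  : Walk R x x []
    _∷ʷ_ : R x y → Walk R y z vs → Walk R x z (y ∷ vs)

  infixr 5 _∷ʷ_ _++ʷ_

  _++ʷ_ : Walk R x y vs → Walk R y z us → Walk R x z (vs ++ us)
  []ʷ      ++ʷ w′ = w′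
  (r ∷ʷ w) ++ʷ w′ = r ∷ʷ (w ++ʷ w′)

  _∷ʳʷ_ : Walk R x y vs → R y z → Walk R x z (vs ++ [ z ])
  w ∷ʳʷ r = w ++ʷ (r ∷ʷ []ʷ)

  mapʷ : (∀ {u v} → R u v → Q u v) → Walk R x y vs → Walk Q x y vs
  mapʷ f []ʷ      = []ʷ
  mapʷ f (r ∷ʷ w) = f r ∷ʷ mapʷ f w

  fromStar : Star R x y → ∃ (Walk R x y)
  fromStar ε       = [] , []ʷ
  fromStar (r ◅ s) = _ , r ∷ʷ proj₂ (fromStar s)

  toStar : Walk R x y vs → Star R x y
  toStar []ʷ      = ε
  toStar (r ∷ʷ w) = r ◅ toStar w

  last≡ : Walk R x y vs → last (x ∷ vs) ≡ just y
  last≡ []ʷ              = refl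
  last≡ (r ∷ʷ []ʷ)       = refl
  last≡ (r ∷ʷ r′ ∷ʷ w)   = last≡ (r′ ∷ʷ w)

  end∈ : Walk R x y vs → y ∈ x ∷ vs
  end∈ []ʷ      = here refl
  end∈ (r ∷ʷ w) = there (end∈ w)

  splitAt : Walk R a b vs → x ∈ a ∷ vs →
    Σ (List A) λ p₁ → Σ (List A) λ p₂ → Σ (List A) λ pre →
      Walk R a x p₁ × Walk R x b p₂ × vs ≡ p₁ ++ p₂ × a ∷ vs ≡ pre ++ x ∷ p₂
  splitAt w (here refl) = [] , _ , [] , []ʷ , w , refl , refl
  splitAt {a = a} (r ∷ʷ w) (there m) with splitAt w m
  ... | p₁ , p₂ , pre , w₁ , w₂ , e₁ , e₂ =
    _ ∷ p₁ , p₂ , a ∷ pre , r ∷ʷ w₁ , w₂ , cong (_ ∷_) e₁ , cong (a ∷_) e₂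

  record Visits (R : Rel A 0ℓ) (a b : A) (vs : List A) (p q : A) : Set where
    field
      {X M Z} : List A
      before  : Walk R a p X
      between : Walk R p q M
      after   : Walk R q b Z
      stops≡  : vs ≡ X ++ M ++ Z

  visitOrder : Walk R a b vs → p ∈ a ∷ vs → q ∈ a ∷ vs → Visits R a b vs p q ⊎ Visits R a b vs q p
  visitOrder w (here refl) mq with splitAt w mq
  ... | _ , _ , _ , w₁ , w₂ , e , _ = inj₁ (record { before = []ʷ ; between = w₁ ; after = w₂ ; stops≡ = e })
  visitOrder w (there mp) (here refl) with splitAt w (there mp)
  ... | _ , _ , _ , w₁ , w₂ , e , _ = inj₂ (record { before = []ʷ ; between = w₁ ; after = w₂ ; stops≡ = e })
  visitOrder (r ∷ʷ w) (there mp) (there mq) = Data.Sum.map extend extend (visitOrder w mp mq)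
    where
    extend : ∀ {p q} → Visits _ _ _ _ p q → Visits _ _ _ _ p q
    extend v = record { before = r ∷ʷ before ; between = between ; after = after ; stops≡ = cong (_ ∷_) stops≡ }
      where open Visits v

  arcs : A → List A → List (A × A)
  arcs x []       = []
  arcs x (y ∷ vs) = (x , y) ∷ arcs y vs

  arc∈⇒∈ : ∀ {u v} → (u , v) ∈ arcs x vs → u ∈ x ∷ vs × v ∈ vs
  arc∈⇒∈ {vs = y ∷ vs} (here refl) = here refl , here refl
  arc∈⇒∈ {vs = y ∷ vs} (there m)   = Data.Product.map there there (arc∈⇒∈ m)

  arcs-∷ʳ : Walk R x y vs → arcs x (vs ++ [ z ]) ≡ arcs x vs ++ [ (y , z) ]
  arcs-∷ʳ []ʷ      = refl
  arcs-∷ʳ (r ∷ʷ w) = cong (_ ∷_) (arcs-∷ʳ w)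

  restrictArcs : ∀ {L : List (A × A)} → Walk R x y vs → (∀ {u v} → (u , v) ∈ arcs x vs → (u , v) ∈ L) →
    Walk (λ u v → R u v × (u , v) ∈ L) x y vs
  restrictArcs []ʷ      f = []ʷ
  restrictArcs (r ∷ʷ w) f = (r , f (here refl)) ∷ʷ restrictArcs w (f ∘ there)

  restrictVertices : Walk R x y vs → Walk (λ u v → R u v × u ∈ x ∷ vs × v ∈ x ∷ vs) x y vs
  restrictVertices w = go w id
    where
    go : ∀ {L x y vs} → Walk R x y vs → (∀ {v} → v ∈ x ∷ vs → v ∈ L) →
      Walk (λ u v → R u v × u ∈ L × v ∈ L) x y vs
    go []ʷ      f = []ʷ
    go (r ∷ʷ w) f = (r , f (here refl) , f (there (here refl))) ∷ʷ go w (f ∘ there)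

  record Reversal (Q : Rel A 0ℓ) (x y : A) (vs : List A) : Set where
    field
      {ws}   : List A
      walk   : Walk Q y x ws
      ⊆-rev  : ∀ {v} → v ∈ x ∷ vs → v ∈ y ∷ ws
      rev-⊆  : ∀ {v} → v ∈ y ∷ ws → v ∈ x ∷ vs
      arcs-rev : ∀ {u v} → (u , v) ∈ arcs y ws → (v , u) ∈ arcs x vs

  reverseʷ : (∀ {u v} → R u v → Q v u) → Walk R x y vs → Reversal Q x y vs
  reverseʷ s []ʷ = record { walk = []ʷ ; ⊆-rev = id ; rev-⊆ = id ; arcs-rev = λ () }
  reverseʷ {x = x} s (_∷ʷ_ {y = y} {z = z} {vs = vs} r w) = record
    { walk = walk ∷ʳʷ s r ; ⊆-rev = fwd ; rev-⊆ = bwd ; arcs-rev = arc }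
    where
    open Reversal (reverseʷ s w)
    fwd : ∀ {v} → v ∈ x ∷ y ∷ vs → v ∈ z ∷ ws ++ [ x ]
    fwd (here refl) = ∈-++⁺ʳ (z ∷ ws) (here refl)
    fwd (there m) with ⊆-rev m
    ... | here e   = here e
    ... | there m′ = there (∈-++⁺ˡ m′)
    bwd : ∀ {v} → v ∈ z ∷ ws ++ [ x ] → v ∈ x ∷ y ∷ vs
    bwd (here e) = there (rev-⊆ (here e))
    bwd (there m) with ∈-++⁻ ws m
    ... | inj₁ m′        = there (rev-⊆ (there m′))
    ... | inj₂ (here e)  = here e
    arc : ∀ {u v} → (u , v) ∈ arcs z (ws ++ [ x ]) → (v , u) ∈ arcs x (y ∷ vs)
    arc m rewrite arcs-∷ʳ {z = x} walk with ∈-++⁻ (arcs z ws) m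
    ... | inj₁ m′          = there (arcs-rev m′)
    ... | inj₂ (here refl) = here refl

  Unique-++⁻ˡ : ∀ (xs : List A) {ys} → Unique (xs ++ ys) → Unique xs
  Unique-++⁻ˡ []       u        = []
  Unique-++⁻ˡ (x ∷ xs) (px ∷ u) = All.++⁻ˡ xs px ∷ Unique-++⁻ˡ xs u

  Unique-++⁻ʳ : ∀ (xs : List A) {ys} → Unique (xs ++ ys) → Unique ys
  Unique-++⁻ʳ []       u        = u
  Unique-++⁻ʳ (x ∷ xs) (px ∷ u) = Unique-++⁻ʳ xs u

  Unique-++⁻-disjoint : ∀ (xs : List A) {ys} → Unique (xs ++ ys) → x ∈ xs → y ∈ ys → x ≢ y
  Unique-++⁻-disjoint (x ∷ xs) (px ∷ u) (here refl) my = All.lookup (All.++⁻ʳ xs px) my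
  Unique-++⁻-disjoint (x ∷ xs) (px ∷ u) (there mx) my = Unique-++⁻-disjoint xs u mx my

  Unique-head∉ : Unique (x ∷ vs) → x ∉ vs
  Unique-head∉ (px ∷ u) m = All.lookup px m refl

  Unique⇒arcs-antisym : Unique (x ∷ vs) → ∀ {u v} → (u , v) ∈ arcs x vs → (v , u) ∈ arcs x vs → ⊥
  Unique⇒arcs-antisym {vs = y ∷ vs} U (here refl) (here e)  = Unique-head∉ U (here (sym (cong proj₁ e)))
  Unique⇒arcs-antisym {vs = y ∷ vs} U (here refl) (there m) = Unique-head∉ U (there (proj₂ (arc∈⇒∈ m)))
  Unique⇒arcs-antisym {vs = y ∷ vs} U (there m) (here refl) = Unique-head∉ U (there (proj₂ (arc∈⇒∈ m)))
  Unique⇒arcs-antisym {vs = y ∷ vs} (_ ∷ U) (there m) (there m′) = Unique⇒arcs-antisym U m m′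

  arc∈-∷ʳ⇒∈ : ∀ (xs : List A) {u v} → (u , v) ∈ arcs x (xs ++ [ y ]) → u ∈ x ∷ xs
  arc∈-∷ʳ⇒∈ []       (here refl) = here refl
  arc∈-∷ʳ⇒∈ (_ ∷ xs) (here refl) = here refl
  arc∈-∷ʳ⇒∈ (_ ∷ xs) (there m)   = there (arc∈-∷ʳ⇒∈ xs m)

  arc-from-head : Walk R x y vs → Unique (x ∷ vs) → ∀ {v} → (x , v) ∈ arcs x vs → R x v
  arc-from-head (r ∷ʷ w) U (here refl) = r
  arc-from-head (r ∷ʷ w) U (there m)   = contradiction (proj₁ (arc∈⇒∈ m)) (Unique-head∉ U)

  module _ (_≟_ : (u v : A) → Dec (u ≡ v)) where
    open import Data.List.Membership.DecPropositional _≟_ using (_∈?_)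

    loopErase : Walk R x z vs → Σ (List A) λ ws → Walk R x z ws × Unique (x ∷ ws)
    loopErase []ʷ = [] , []ʷ , [] ∷ []
    loopErase {x = x} (_∷ʷ_ {y = y} r w) with loopErase w
    ... | ws , w′ , U with x ∈? (y ∷ ws)
    ... | yes m with splitAt w′ m
    ...   | _ , p₂ , pre , _ , w₂ , _ , e = p₂ , w₂ , Unique-++⁻ʳ pre (subst Unique e U)
    loopErase {x = x} (_∷ʷ_ {y = y} r w) | ws , w′ , U | no x∉ =
      y ∷ ws , r ∷ʷ w′ , All.tabulate (λ m e → x∉ (subst (_∈ _) (sym e) m)) ∷ U

    record FirstEntry (R : Rel A 0ℓ) (L : List A) (x : A) (P : List A) : Set where
      field
        {lastOut entry} : A
        {prefix rest}   : List A
        outside  : Walk R x lastOut prefix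
        enter    : R lastOut entry
        entry∈   : entry ∈ L
        outside∉ : ∀ {z} → z ∈ x ∷ prefix → z ∉ L
        P≡       : P ≡ prefix ++ entry ∷ rest

    firstEntry : ∀ L → Walk R x y vs → x ∉ L → y ∈ L → FirstEntry R L x vs
    firstEntry L []ʷ x∉ y∈ = contradiction y∈ x∉
    firstEntry L (_∷ʷ_ {y = z} r w) x∉ y∈ with z ∈? L
    ... | yes z∈ = record { outside = []ʷ ; enter = r ; entry∈ = z∈ ; outside∉ = λ { (here refl) → x∉ } ; P≡ = refl }
    ... | no z∉ = record
      { outside = r ∷ʷ outside ; enter = enter ; entry∈ = entry∈
      ; outside∉ = λ { (here refl) → x∉ ; (there m) → outside∉ m } ; P≡ = cong (z ∷_) P≡ }
      where open FirstEntry (firstEntry L w z∉ y∈)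

module FilterLength {A : Set} {P Q : A → Set} (P? : ∀ x → Dec (P x)) (Q? : ∀ x → Dec (Q x))
                    (P⇒Q : ∀ {x} → P x → Q x) where

  length-filter-mono : ∀ xs → length (filter P? xs) ≤ length (filter Q? xs)
  length-filter-mono []       = z≤n
  length-filter-mono (x ∷ xs) with P? x | Q? x
  ... | yes _ | yes _ = s≤s (length-filter-mono xs)
  ... | yes p | no ¬q = contradiction (P⇒Q p) ¬q
  ... | no _  | yes _ = m≤n⇒m≤1+n (length-filter-mono xs)
  ... | no _  | no _  = length-filter-mono xs

  length-filter-mono-< : ∀ xs {y} → y ∈ xs → Q y → ¬ P y → length (filter P? xs) < length (filter Q? xs)
  length-filter-mono-< (x ∷ xs) (here refl) q ¬p with P? x | Q? x
  ... | yes p | _     = contradiction p ¬p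
  ... | no _  | yes _ = s≤s (length-filter-mono xs)
  ... | no _  | no ¬q = contradiction q ¬q
  length-filter-mono-< (x ∷ xs) (there m) q ¬p with P? x | Q? x
  ... | yes _ | yes _ = s≤s (length-filter-mono-< xs m q ¬p)
  ... | yes p | no ¬q = contradiction (P⇒Q p) ¬q
  ... | no _  | yes _ = m≤n⇒m≤1+n (length-filter-mono-< xs m q ¬p)
  ... | no _  | no _  = length-filter-mono-< xs m q ¬p

module Saturation {n : ℕ} where
  open import Data.List.Membership.DecPropositional (_≟ᶠ_ {n}) using (_∈?_)

  uncovered : List (Fin n) → ℕ
  uncovered L = length (filter (λ x → ¬? (x ∈? L)) (allFin n))

  uncovered-< : ∀ {L L′} → L ⊆ L′ → ∀ {y} → y ∈ L′ → y ∉ L → uncovered L′ < uncovered L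
  uncovered-< {L} {L′} L⊆L′ {y} y∈L′ y∉L =
    length-filter-mono-< (allFin n) (∈-allFin y) y∉L (λ y∉L′ → y∉L′ y∈L′)
    where open FilterLength (λ x → ¬? (x ∈? L′)) (λ x → ¬? (x ∈? L)) (λ z∉L′ z∈L → z∉L′ (L⊆L′ z∈L))

  module _ (R : Rel (Fin n) 0ℓ) (R? : Decidable R) where

    Closed : List (Fin n) → Set
    Closed L = ∀ {x y} → x ∈ L → R x y → y ∈ L

    ExitEdge : List (Fin n) → Set
    ExitEdge L = Σ (Fin n) λ x → Σ (Fin n) λ y → x ∈ L × y ∉ L × R x y

    exitEdge? : ∀ L → ExitEdge L ⊎ Closed L
    exitEdge? L with any? (λ x → any? (λ y → x ∈? L ×-dec ¬? (y ∈? L) ×-dec R? x y))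
    ... | yes (x , y , e) = inj₁ (x , y , e)
    ... | no ¬exit = inj₂ closed
      where
      closed : Closed L
      closed {x} {y} x∈L r with y ∈? L
      ... | yes y∈L = y∈L
      ... | no y∉L  = contradiction (x , y , x∈L , y∉L , r) ¬exit

    Closed-Star : ∀ {L x y} → Closed L → x ∈ L → Star R x y → y ∈ L
    Closed-Star closed x∈L ε       = x∈L
    Closed-Star closed x∈L (r ◅ s) = Closed-Star closed (closed x∈L r) s

    -- Each extension covers a new vertex, so uncovered (verts s) bounds the recursion.
    module _ {S : Set} (verts : S → List (Fin n))
             (extend : ∀ s {x y} → x ∈ verts s → y ∉ verts s → R x y →
                       Σ S λ s′ → verts s ⊆ verts s′ × y ∈ verts s′) where

      saturate : ∀ s → Σ S λ s′ → verts s ⊆ verts s′ × Closed (verts s′)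
      saturate s = go (uncovered (verts s)) s ≤-refl
        where
        go : ∀ k s → uncovered (verts s) ≤ k → Σ S λ s′ → verts s ⊆ verts s′ × Closed (verts s′)
        go k s bound with exitEdge? (verts s)
        ... | inj₂ closed = s , id , closed
        ... | inj₁ (x , y , x∈ , y∉ , r) with extend s x∈ y∉ r
        ...   | s′ , s⊆s′ , y∈ with k | <-≤-trans (uncovered-< s⊆s′ y∈ y∉) bound
        ...     | zero  | ()
        ...     | suc k | s′<k+1 with go k s′ (≤-pred s′<k+1)
        ...       | s″ , s′⊆s″ , closed = s″ , s′⊆s″ ∘ s⊆s′ , closed

    Star? : Decidable (Star R)
    Star? u v with saturate proj₁ extendReach ((u ∷ []) , λ { (here refl) → ε })
      where
      Reachable : Set
      Reachable = Σ (List (Fin n)) λ L → ∀ {x} → x ∈ L → Star R u x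
      extendReach : ∀ (s : Reachable) {x y} → x ∈ proj₁ s → y ∉ proj₁ s → R x y →
        Σ Reachable λ s′ → proj₁ s ⊆ proj₁ s′ × y ∈ proj₁ s′
      extendReach (L , reach) {x} {y} x∈L _ r =
        (y ∷ L , λ { (here refl) → reach x∈L ◅◅ (r ◅ ε) ; (there m) → reach m }) , there , here refl
    ... | (L , reach) , u∈L , closed with v ∈? L
    ...   | yes v∈L = yes (reach v∈L)
    ...   | no v∉L  = no (λ uv → v∉L (Closed-Star closed (u∈L (here refl)) uv))

module GraphFacts {n : ℕ} (G : Graph n) where
  open Saturation using (Star?)
  open Walks

  Adj-sym : ∀ {u v} → Adj G u v → Adj G v u
  Adj-sym {u} {v} = subst T (Graph.sym G u v)

  Adj-irrefl : ∀ {u} → ¬ Adj G u u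
  Adj-irrefl {u} = subst T (irrefl G u)

  Adj? : Decidable (Adj G)
  Adj? u v = T? (adj G u v)

  SameEdge? : ∀ (a b u v : Fin n) → Dec (SameEdge a b u v)
  SameEdge? a b u v = (a ≟ᶠ u ×-dec b ≟ᶠ v) ⊎-dec (a ≟ᶠ v ×-dec b ≟ᶠ u)

  AdjMinus-sym : ∀ {s w} → Sym (AdjMinus G s w) (AdjMinus G s w)
  AdjMinus-sym (a , ne) = Adj-sym a , ne ∘ Data.Sum.swap ∘ Data.Sum.map Data.Product.swap Data.Product.swap

  AdjMinus-flip : ∀ {s w x y} → AdjMinus G s w x y → AdjMinus G w s x y
  AdjMinus-flip (a , ne) = a , ne ∘ Data.Sum.swap

  AdjMinus? : ∀ s w → Decidable (AdjMinus G s w)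
  AdjMinus? s w x y = Adj? x y ×-dec ¬? (SameEdge? x y s w)

  Bridge? : Decidable (Bridge G)
  Bridge? s w = Adj? s w ×-dec ¬? (Star? (AdjMinus G s w) (AdjMinus? s w) s w)

  nonBridge⇒detour : ∀ {s w} → Adj G s w → ¬ Bridge G s w → Star (AdjMinus G s w) w s
  nonBridge⇒detour {s} {w} sw ¬bridge with Star? (AdjMinus G s w) (AdjMinus? s w) s w
  ... | yes s→w = Star.reverse AdjMinus-sym s→w
  ... | no ¬s→w = contradiction (sw , ¬s→w) ¬bridge

  Bridge-sym : Sym (Bridge G) (Bridge G)
  Bridge-sym (a , disconnected) = Adj-sym a , disconnected ∘ Star.reverse AdjMinus-sym ∘ Star.map AdjMinus-flip

  NonBridgeAdj-sym : Sym (NonBridgeAdj G) (NonBridgeAdj G)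
  NonBridgeAdj-sym (a , ¬bridge) = Adj-sym a , ¬bridge ∘ Bridge-sym

  SameBlock-sym : Sym (SameBlock G) (SameBlock G)
  SameBlock-sym = Star.reverse NonBridgeAdj-sym

  IncidentBlock-resp : ∀ {x y} e → SameBlock G x y → IncidentBlock G y e → IncidentBlock G x e
  IncidentBlock-resp e xy = Data.Sum.map (xy ◅◅_) (xy ◅◅_)

  toBr : ∀ {s w} → Bridge G s w → Br G
  toBr {s} {w} b with <-cmp s w
  ... | tri< s<w _ _ = s , w , s<w , b
  ... | tri≈ _ refl _ = contradiction (proj₁ b) Adj-irrefl
  ... | tri> _ _ w<s = w , s , w<s , Bridge-sym b

  toBr-ends : ∀ {s w} (b : Bridge G s w) → brEnds G (toBr b) ≡ (s , w) ⊎ brEnds G (toBr b) ≡ (w , s)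
  toBr-ends {s} {w} b with <-cmp s w
  ... | tri< _ _ _ = inj₁ refl
  ... | tri≈ _ refl _ = contradiction (proj₁ b) Adj-irrefl
  ... | tri> _ _ _ = inj₂ refl

  private
    ends-incident : ∀ e {u v} → brEnds G e ≡ (u , v) → IncidentBlock G u e × IncidentBlock G v e
    ends-incident e refl = inj₁ ε , inj₂ ε

  toBr-incident : ∀ {s w} (b : Bridge G s w) → IncidentBlock G s (toBr b) × IncidentBlock G w (toBr b)
  toBr-incident b with toBr-ends b
  ... | inj₁ e = ends-incident (toBr b) e
  ... | inj₂ e = Data.Product.swap (ends-incident (toBr b) e)

  BridgeIn : List (Fin n) → Br G → Set
  BridgeIn L (u , v , _) = u ∈ L × v ∈ L

  private
    ends-in : ∀ e {u v L} → brEnds G e ≡ (u , v) → u ∈ L → v ∈ L → BridgeIn L e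
    ends-in e refl = _,_

  BridgeIn-⊆ : ∀ {L L′} → L ⊆ L′ → ∀ e → BridgeIn L e → BridgeIn L′ e
  BridgeIn-⊆ L⊆L′ e = Data.Product.map L⊆L′ L⊆L′

  toBr-in : ∀ {L s w} (b : Bridge G s w) → s ∈ L → w ∈ L → BridgeIn L (toBr b)
  toBr-in b s∈ w∈ with toBr-ends b
  ... | inj₁ e = ends-in (toBr b) e s∈ w∈
  ... | inj₂ e = ends-in (toBr b) e w∈ s∈

  toBr-distinct : ∀ {L s w} (b : Bridge G s w) → w ∉ L → ∀ e → BridgeIn L e → DistinctBr G e (toBr b)
  toBr-distinct {L} b w∉ (u , v , _) (u∈ , v∈) eq with toBr-ends b
  ... | inj₁ e = w∉ (subst (_∈ L) (cong proj₂ (trans eq e)) v∈)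
  ... | inj₂ e = w∉ (subst (_∈ L) (cong proj₁ (trans eq e)) u∈)

  BetweenBridges : List (Fin n) → Fin n → Set
  BetweenBridges L x = Σ (Br G) λ e₁ → Σ (Br G) λ e₂ → DistinctBr G e₁ e₂ ×
    BridgeIn L e₁ × BridgeIn L e₂ × IncidentBlock G x e₁ × IncidentBlock G x e₂

  BetweenBridges-⊆ : ∀ {L L′ x} → L ⊆ L′ → BetweenBridges L x → BetweenBridges L′ x
  BetweenBridges-⊆ L⊆L′ (e₁ , e₂ , d , in₁ , in₂ , i₁ , i₂) =
    e₁ , e₂ , d , BridgeIn-⊆ L⊆L′ e₁ in₁ , BridgeIn-⊆ L⊆L′ e₂ in₂ , i₁ , i₂

  BetweenBridges-resp : ∀ {L x y} → SameBlock G x y → BetweenBridges L y → BetweenBridges L x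
  BetweenBridges-resp xy (e₁ , e₂ , d , in₁ , in₂ , i₁ , i₂) =
    e₁ , e₂ , d , in₁ , in₂ , IncidentBlock-resp e₁ xy i₁ , IncidentBlock-resp e₂ xy i₂

  Bridge-separates : ∀ {s w z} → Bridge G s w → Star (AdjMinus G s w) s z → ¬ SameBlock G z w
  Bridge-separates {s} {w} b sz zw = proj₂ b (sz ◅◅ Star.map avoid zw)
    where
    avoid : ∀ {x y} → NonBridgeAdj G x y → AdjMinus G s w x y
    avoid (a , ¬bridge) = a , λ { (inj₁ (refl , refl)) → ¬bridge b ; (inj₂ (refl , refl)) → ¬bridge (Bridge-sym b) }

  -- Together with the edge sw, a path from w to s avoiding sw is a cycle.  Each edge xy of
  -- the cycle is no bridge: the rest of the cycle joins x and y.
  cycle-inBlock : ∀ {s w x Q} (P₁ : List (Fin n)) → Adj G s w →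
    Walk (AdjMinus G s w) w x P₁ → Walk (AdjMinus G s w) x s Q → Unique (w ∷ P₁ ++ Q) →
    ∀ {z} → z ∈ x ∷ Q → SameBlock G z s
  cycle-inBlock P₁ sw w→x []ʷ U (here refl) = ε
  cycle-inBlock {s} {w} {x} P₁ sw w→x (_∷ʷ_ {y = y} {vs = Q} r y→s) U = go
    where
    y∉ : y ∉ w ∷ P₁
    y∉ y∈ = Unique-++⁻-disjoint (w ∷ P₁) U y∈ (here refl) refl
    x∉ : ∀ {z} → z ∈ y ∷ Q → x ≢ z
    x∉ = Unique-++⁻-disjoint (w ∷ P₁) U (end∈ w→x)
    avoid-y : ∀ {u v} → AdjMinus G s w u v × u ∈ w ∷ P₁ × v ∈ w ∷ P₁ → AdjMinus G x y u v
    avoid-y ((a , _) , u∈ , v∈) = a , λ { (inj₁ (_ , refl)) → y∉ v∈ ; (inj₂ (refl , _)) → y∉ u∈ }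
    avoid-x : ∀ {u v} → AdjMinus G s w u v × u ∈ y ∷ Q × v ∈ y ∷ Q → AdjMinus G x y u v
    avoid-x ((a , _) , u∈ , v∈) = a , λ { (inj₁ (refl , _)) → x∉ u∈ refl ; (inj₂ (_ , refl)) → x∉ v∈ refl }
    ws : AdjMinus G x y w s
    ws = Adj-sym sw , λ { (inj₁ (refl , refl)) → proj₂ r (inj₂ (refl , refl))
                        ; (inj₂ (refl , refl)) → proj₂ r (inj₁ (refl , refl)) }
    x~y : NonBridgeAdj G x y
    x~y = proj₁ r , λ b → proj₂ b
      (Star.reverse AdjMinus-sym (toStar (mapʷ avoid-y (restrictVertices w→x))) ◅◅
       ws ◅ Star.reverse AdjMinus-sym (toStar (mapʷ avoid-x (restrictVertices y→s))))
    rest : ∀ {z} → z ∈ y ∷ Q → SameBlock G z s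
    rest = cycle-inBlock (P₁ ++ [ y ]) sw (w→x ∷ʳʷ r) y→s
             (subst (λ l → Unique (w ∷ l)) (sym (++-assoc P₁ [ y ] Q)) U)
    go : ∀ {z} → z ∈ x ∷ y ∷ Q → SameBlock G z s
    go (here refl) = x~y ◅ rest (here refl)
    go (there m)   = rest m

module Tours {n : ℕ} (G : Graph n) where
  open GraphFacts G
  open Walks
  open Saturation using (saturate; Closed-Star)

  Arcs : Set
  Arcs = List (Fin n × Fin n)

  Step : Arcs → Rel (Fin n) 0ℓ
  Step A u v = Adj G u v × (u , v) ∈ A

  Step-⊆ : ∀ {A A′ : Arcs} → A ⊆ A′ → ∀ {u v} → Step A u v → Step A′ u v
  Step-⊆ A⊆A′ = Data.Product.map₂ A⊆A′

  Route : Arcs → Fin n → Fin n → Set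
  Route A x y = ∃ (Walk (Step A) x y)

  Route-⊆ : ∀ {A A′ : Arcs} → A ⊆ A′ → ∀ {x y} → Route A x y → Route A′ x y
  Route-⊆ A⊆A′ (_ , w) = _ , mapʷ (Step-⊆ A⊆A′) w

  _++ʳ_ : ∀ {A x y z} → Route A x y → Route A y z → Route A x z
  (_ , w) ++ʳ (_ , w′) = _ , w ++ʷ w′

  BridgeAt : List (Fin n) → Fin n → Set
  BridgeAt L x = Σ (Br G) λ e → BridgeIn L e × IncidentBlock G x e

  BridgeAt-⊆ : ∀ {L L′} → L ⊆ L′ → ∀ {x} → BridgeAt L x → BridgeAt L′ x
  BridgeAt-⊆ L⊆L′ (e , inL , i) = e , BridgeIn-⊆ L⊆L′ e inL , i

  -- Within the blocks of its two ends it can reach the end vertices; every other block it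
  -- visits already meets two of its bridges, so when Δ(G*) ≤ 2 no further bridge leaves it.
  record Tour : Set where
    field
      arcSet     : Arcs
      start end  : Fin n
      stops      : List (Fin n)
      walk       : Walk (Step arcSet) start end stops
      arcs-on    : ∀ {u v} → (u , v) ∈ arcSet → u ∈ start ∷ stops × v ∈ start ∷ stops
      antisym    : ∀ {u v} → (u , v) ∈ arcSet → (v , u) ∈ arcSet → ⊥
      toStart    : ∀ {x} → x ∈ start ∷ stops → SameBlock G x start → Route arcSet x start
      fromEnd    : ∀ {x} → x ∈ start ∷ stops → SameBlock G x end → Route arcSet end x
      startBridge : SameBlock G start end ⊎ BridgeAt (start ∷ stops) start
      endBridge  : SameBlock G start end ⊎ BridgeAt (start ∷ stops) end
      blockShape : ∀ {x} → x ∈ start ∷ stops →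
                   SameBlock G x start ⊎ SameBlock G x end ⊎ BetweenBridges (start ∷ stops) x

  vertices : Tour → List (Fin n)
  vertices t = Tour.start t ∷ Tour.stops t

  singletonTour : Fin n → Tour
  singletonTour u = record
    { arcSet = [] ; start = u ; end = u ; stops = [] ; walk = []ʷ
    ; arcs-on = λ () ; antisym = λ ()
    ; toStart = λ { (here refl) _ → [] , []ʷ } ; fromEnd = λ { (here refl) _ → [] , []ʷ }
    ; startBridge = inj₁ ε ; endBridge = inj₁ ε ; blockShape = λ { (here refl) → inj₁ ε } }

  module ReverseTour (t : Tour) where
    open Tour t

    private
      arcSet′ : Arcs
      arcSet′ = Data.List.map Data.Product.swap arcSet

      swapStep : ∀ {u v} → Step arcSet u v → Step arcSet′ v u
      swapStep (a , m) = Adj-sym a , ∈-map⁺ Data.Product.swap m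

      unswap : ∀ {u v} → (u , v) ∈ arcSet′ → (v , u) ∈ arcSet
      unswap m with ∈-map⁻ Data.Product.swap m
      ... | _ , m′ , refl = m′

      rev : Reversal (Step arcSet′) start end stops
      rev = reverseʷ swapStep walk
      open Reversal rev using (ws; ⊆-rev; rev-⊆)

      reverseRoute : ∀ {x y} → Route arcSet x y → Route arcSet′ y x
      reverseRoute (_ , w) = _ , Reversal.walk (reverseʷ swapStep w)

      swapEnds : ∀ {x} → SameBlock G x start ⊎ SameBlock G x end ⊎ BetweenBridges (start ∷ stops) x →
        SameBlock G x end ⊎ SameBlock G x start ⊎ BetweenBridges (end ∷ ws) x
      swapEnds (inj₁ x~a)        = inj₂ (inj₁ x~a)
      swapEnds (inj₂ (inj₁ x~b)) = inj₁ x~b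
      swapEnds (inj₂ (inj₂ bb))  = inj₂ (inj₂ (BetweenBridges-⊆ ⊆-rev bb))

    reverseTour : Tour
    reverseTour = record
      { arcSet = arcSet′ ; start = end ; end = start ; stops = ws ; walk = Reversal.walk rev
      ; arcs-on = λ m → let (m₁ , m₂) = arcs-on (unswap m) in ⊆-rev m₂ , ⊆-rev m₁
      ; antisym = λ m m′ → antisym (unswap m′) (unswap m)
      ; toStart = λ m x~b → reverseRoute (fromEnd (rev-⊆ m) x~b)
      ; fromEnd = λ m x~a → reverseRoute (toStart (rev-⊆ m) x~a)
      ; startBridge = Data.Sum.map SameBlock-sym (BridgeAt-⊆ ⊆-rev) endBridge
      ; endBridge = Data.Sum.map SameBlock-sym (BridgeAt-⊆ ⊆-rev) startBridge
      ; blockShape = swapEnds ∘ blockShape ∘ rev-⊆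
      }

    ⊆-reverseTour : vertices t ⊆ vertices reverseTour
    ⊆-reverseTour = ⊆-rev

    reverseTour-⊆ : vertices reverseTour ⊆ vertices t
    reverseTour-⊆ = rev-⊆

  Extension : Tour → Fin n → Set
  Extension t w = Σ Tour λ t′ → vertices t ⊆ vertices t′ × w ∈ vertices t′

  arc-avoids : ∀ t {s w u v} → w ∉ vertices t → Step (Tour.arcSet t) u v → AdjMinus G s w u v
  arc-avoids t w∉ (a , m) =
    a , λ { (inj₁ (_ , refl)) → w∉ (proj₂ (arcs-on m)) ; (inj₂ (refl , _)) → w∉ (proj₁ (arcs-on m)) }
    where open Tour t

  tour-connects-avoiding : ∀ t {s w z} → s ∈ vertices t → w ∉ vertices t → z ∈ vertices t → Star (AdjMinus G s w) s z
  tour-connects-avoiding t s∈ w∉ z∈ with visitOrder (Tour.walk t) s∈ z∈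
  ... | inj₁ v = toStar (mapʷ (arc-avoids t w∉) (Visits.between v))
  ... | inj₂ v = Star.reverse AdjMinus-sym (toStar (mapʷ (arc-avoids t w∉) (Visits.between v)))

  farBlock-disjoint : ∀ t {s w z} → s ∈ vertices t → w ∉ vertices t → Bridge G s w → z ∈ vertices t → ¬ SameBlock G z w
  farBlock-disjoint t s∈ w∉ b z∈ = Bridge-separates b (tour-connects-avoiding t s∈ w∉ z∈)

  -- Walk back from end to s inside the end block, then cross the bridge sw.
  module CrossBridge (t : Tour) {s w} (s∈ : s ∈ vertices t) (w∉ : w ∉ vertices t)
                     (b : Bridge G s w) (s~end : SameBlock G s (Tour.end t)) where
    open Tour t

    private
      back : Route arcSet end s
      back = fromEnd s∈ s~end

      arcSet′ : Arcs
      arcSet′ = (s , w) ∷ arcSet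

      stops′ V′ : List (Fin n)
      stops′ = stops ++ proj₁ back ++ [ w ]
      V′ = start ∷ stops′

      eᵇ : Br G
      eᵇ = toBr b

      old⊆ : start ∷ stops ⊆ V′
      old⊆ (here e)  = here e
      old⊆ (there m) = there (∈-++⁺ˡ m)

      w∈ : w ∈ V′
      w∈ = there (∈-++⁺ʳ stops (∈-++⁺ʳ (proj₁ back) (here refl)))

      back⊆ : ∀ {u v xs} → Walk (Step arcSet) u v xs → xs ⊆ start ∷ stops
      back⊆ ((_ , m) ∷ʷ _) (here refl) = proj₂ (arcs-on m)
      back⊆ (_ ∷ʷ w) (there z)         = back⊆ w z

      old-or-w : ∀ {z} → z ∈ V′ → z ∈ start ∷ stops ⊎ z ≡ w
      old-or-w (here e) = inj₁ (here e)
      old-or-w (there m) with ∈-++⁻ stops m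
      ... | inj₁ m′ = inj₁ (there m′)
      ... | inj₂ m′ with ∈-++⁻ (proj₁ back) m′
      ...   | inj₁ m″ = inj₁ (back⊆ (proj₂ back) m″)
      ...   | inj₂ (here e) = inj₂ e

      w-alone : ∀ {z} → z ∈ start ∷ stops → ¬ SameBlock G z w
      w-alone = farBlock-disjoint t s∈ w∉ b

      walk′ : Walk (Step arcSet′) start w stops′
      walk′ = mapʷ (Step-⊆ there) walk ++ʷ (mapʷ (Step-⊆ there) (proj₂ back) ∷ʳʷ (proj₁ b , here refl))

      arcs-on′ : ∀ {u v} → (u , v) ∈ arcSet′ → u ∈ V′ × v ∈ V′
      arcs-on′ (here refl) = old⊆ s∈ , w∈
      arcs-on′ (there m)   = Data.Product.map old⊆ old⊆ (arcs-on m)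

      antisym′ : ∀ {u v} → (u , v) ∈ arcSet′ → (v , u) ∈ arcSet′ → ⊥
      antisym′ (here refl) (here e)  = w∉ (subst (_∈ _) (sym (cong proj₁ e)) s∈)
      antisym′ (here refl) (there m) = w∉ (proj₁ (arcs-on m))
      antisym′ (there m) (here e)    = w∉ (subst (_∈ _) (cong proj₂ e) (proj₁ (arcs-on m)))
      antisym′ (there m) (there m′)  = antisym m m′

      toStart′ : ∀ {x} → x ∈ V′ → SameBlock G x start → Route arcSet′ x start
      toStart′ m x~a with old-or-w m
      ... | inj₁ m′   = Route-⊆ there (toStart m′ x~a)
      ... | inj₂ refl = contradiction (SameBlock-sym x~a) (w-alone (here refl))

      fromEnd′ : ∀ {x} → x ∈ V′ → SameBlock G x w → Route arcSet′ w x
      fromEnd′ m x~w with old-or-w m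
      ... | inj₁ m′   = contradiction x~w (w-alone m′)
      ... | inj₂ refl = [] , []ʷ

      eᵇ-in : BridgeIn V′ eᵇ
      eᵇ-in = toBr-in b (old⊆ s∈) w∈

      eᵇ-at-end : ∀ {x} → SameBlock G x end → IncidentBlock G x eᵇ
      eᵇ-at-end x~b = IncidentBlock-resp eᵇ (x~b ◅◅ SameBlock-sym s~end) (proj₁ (toBr-incident b))

      startBridge′ : SameBlock G start w ⊎ BridgeAt V′ start
      startBridge′ with startBridge
      ... | inj₁ a~b = inj₂ (eᵇ , eᵇ-in , eᵇ-at-end a~b)
      ... | inj₂ e   = inj₂ (BridgeAt-⊆ old⊆ e)

      -- An old vertex in the end block now lies between the old end bridge and sw.
      oldEndBlock : ∀ {x} → SameBlock G x end → SameBlock G x start ⊎ SameBlock G x w ⊎ BetweenBridges V′ x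
      oldEndBlock x~b with endBridge
      ... | inj₁ a~b = inj₁ (x~b ◅◅ SameBlock-sym a~b)
      ... | inj₂ (e , e-in , i) = inj₂ (inj₂ (e , eᵇ , toBr-distinct b w∉ e e-in , BridgeIn-⊆ old⊆ e e-in ,
                                               eᵇ-in , IncidentBlock-resp e x~b i , eᵇ-at-end x~b))

      blockShape′ : ∀ {x} → x ∈ V′ → SameBlock G x start ⊎ SameBlock G x w ⊎ BetweenBridges V′ x
      blockShape′ m with old-or-w m
      ... | inj₂ refl = inj₂ (inj₁ ε)
      ... | inj₁ m′ with blockShape m′
      ...   | inj₁ x~a        = inj₁ x~a
      ...   | inj₂ (inj₁ x~b) = oldEndBlock x~b
      ...   | inj₂ (inj₂ bb)  = inj₂ (inj₂ (BetweenBridges-⊆ old⊆ bb))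

    crossBridge : Extension t w
    crossBridge = record
      { arcSet = arcSet′ ; start = start ; end = w ; stops = stops′ ; walk = walk′
      ; arcs-on = arcs-on′ ; antisym = antisym′ ; toStart = toStart′ ; fromEnd = fromEnd′
      ; startBridge = startBridge′ ; endBridge = inj₂ (eᵇ , eᵇ-in , proj₂ (toBr-incident b))
      ; blockShape = blockShape′ } , old⊆ , w∈

  record Ear (t : Tour) (s w : Fin n) : Set where
    field
      {src dst}  : Fin n
      {inner}    : List (Fin n)
      path       : Walk (Adj G) src dst inner
      src∈       : src ∈ vertices t
      dst∈       : dst ∈ vertices t
      inBlock    : ∀ {z} → z ∈ src ∷ inner → SameBlock G z s
      antisym    : ∀ {u v} → (u , v) ∈ arcs src inner → (v , u) ∈ arcs src inner → ⊥
      fresh      : ∀ {u v} → (u , v) ∈ arcs src inner → u ∉ vertices t ⊎ v ∉ vertices t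
      w∈inner    : w ∈ inner

  reverseEar : ∀ {t s w} → w ∉ vertices t → Ear t s w → Ear t s w
  reverseEar {t} {w = w} w∉ ear = record
    { path = walk ; src∈ = dst∈ ; dst∈ = src∈
    ; inBlock = inBlock ∘ rev-⊆
    ; antisym = λ m m′ → antisym (arcs-rev m′) (arcs-rev m)
    ; fresh = Data.Sum.swap ∘ fresh ∘ arcs-rev
    ; w∈inner = w∈ws (⊆-rev (there w∈inner)) }
    where
    open Ear ear
    open Reversal (reverseʷ Adj-sym path)
    w∈ws : w ∈ dst ∷ ws → w ∈ ws
    w∈ws (here refl) = contradiction dst∈ w∉
    w∈ws (there m)   = m

  -- Splice the ear into the tour at the place where the tour visits dst and then src:
  -- the tour goes dst → src, returns along the ear to dst, and repeats dst → src.
  module InsertEar (t : Tour) {s w} (s∈ : s ∈ vertices t) (ear : Ear t s w)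
                   (order : Visits (Step (Tour.arcSet t)) (Tour.start t) (Tour.end t) (Tour.stops t)
                                   (Ear.dst ear) (Ear.src ear)) where
    open Tour t
    open Ear ear renaming (antisym to ear-antisym)
    open Visits order

    private
      arcSet′ : Arcs
      arcSet′ = arcs src inner ++ arcSet

      stops′ V′ : List (Fin n)
      stops′ = X ++ M ++ inner ++ M ++ Z
      V′ = start ∷ stops′

      old : arcSet ⊆ arcSet′
      old = ∈-++⁺ʳ (arcs src inner)

      path′ : Walk (Step arcSet′) src dst inner
      path′ = restrictArcs path ∈-++⁺ˡ

      walk′ : Walk (Step arcSet′) start end stops′
      walk′ = lift before ++ʷ lift between ++ʷ path′ ++ʷ lift between ++ʷ lift after
        where
        lift : ∀ {u v xs} → Walk (Step arcSet) u v xs → Walk (Step arcSet′) u v xs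
        lift = mapʷ (Step-⊆ old)

      old⊆ : start ∷ stops ⊆ V′
      old⊆ (here e) = here e
      old⊆ (there m) with ∈-++⁻ X (subst (_ ∈_) stops≡ m)
      ... | inj₁ m₁ = there (∈-++⁺ˡ m₁)
      ... | inj₂ m₂ with ∈-++⁻ M m₂
      ...   | inj₁ m₃ = there (∈-++⁺ʳ X (∈-++⁺ˡ m₃))
      ...   | inj₂ m₄ = there (∈-++⁺ʳ X (∈-++⁺ʳ M (∈-++⁺ʳ inner (∈-++⁺ʳ M m₄))))

      inner⊆ : inner ⊆ stops′
      inner⊆ = ∈-++⁺ʳ X ∘ ∈-++⁺ʳ M ∘ ∈-++⁺ˡ

      ear⊆ : src ∷ inner ⊆ V′
      ear⊆ (here refl) = old⊆ src∈
      ear⊆ (there m)   = there (inner⊆ m)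

      back : X ++ M ++ Z ⊆ start ∷ stops
      back = there ∘ subst (_ ∈_) (sym stops≡)

      old-or-inner : ∀ {z} → z ∈ V′ → z ∈ start ∷ stops ⊎ z ∈ inner
      old-or-inner (here e) = inj₁ (here e)
      old-or-inner (there m) with ∈-++⁻ X m
      ... | inj₁ m₁ = inj₁ (back (∈-++⁺ˡ m₁))
      ... | inj₂ m₂ with ∈-++⁻ M m₂
      ...   | inj₁ m₃ = inj₁ (back (∈-++⁺ʳ X (∈-++⁺ˡ m₃)))
      ...   | inj₂ m₄ with ∈-++⁻ inner m₄
      ...     | inj₁ m₅ = inj₂ m₅
      ...     | inj₂ m₆ = inj₁ (back (∈-++⁺ʳ X m₆))

      arcs-on′ : ∀ {u v} → (u , v) ∈ arcSet′ → u ∈ V′ × v ∈ V′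
      arcs-on′ m with ∈-++⁻ (arcs src inner) m
      ... | inj₁ m₁ = Data.Product.map ear⊆ (there ∘ inner⊆) (arc∈⇒∈ m₁)
      ... | inj₂ m₂ = Data.Product.map old⊆ old⊆ (arcs-on m₂)

      antisym′ : ∀ {u v} → (u , v) ∈ arcSet′ → (v , u) ∈ arcSet′ → ⊥
      antisym′ m m′ with ∈-++⁻ (arcs src inner) m | ∈-++⁻ (arcs src inner) m′
      ... | inj₁ m₁ | inj₁ m₂ = ear-antisym m₁ m₂
      ... | inj₂ m₁ | inj₂ m₂ = antisym m₁ m₂
      ... | inj₁ m₁ | inj₂ m₂ = [ (λ u∉ → u∉ (proj₂ (arcs-on m₂))) , (λ v∉ → v∉ (proj₁ (arcs-on m₂))) ]′ (fresh m₁)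
      ... | inj₂ m₁ | inj₁ m₂ = [ (λ v∉ → v∉ (proj₂ (arcs-on m₁))) , (λ u∉ → u∉ (proj₁ (arcs-on m₁))) ]′ (fresh m₂)

      -- A new vertex reaches the tour along the rest of the ear, which ends in the block of s.
      toStart′ : ∀ {x} → x ∈ V′ → SameBlock G x start → Route arcSet′ x start
      toStart′ m x~a with old-or-inner m
      ... | inj₁ m′ = Route-⊆ old (toStart m′ x~a)
      ... | inj₂ m′ with splitAt path′ (there m′)
      ...   | _ , _ , _ , _ , x→dst , _ , _ =
        (_ , x→dst) ++ʳ Route-⊆ old (toStart dst∈ (inBlock (end∈ path) ◅◅ SameBlock-sym (inBlock (there m′)) ◅◅ x~a))

      fromEnd′ : ∀ {x} → x ∈ V′ → SameBlock G x end → Route arcSet′ end x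
      fromEnd′ m x~b with old-or-inner m
      ... | inj₁ m′ = Route-⊆ old (fromEnd m′ x~b)
      ... | inj₂ m′ with splitAt path′ (there m′)
      ...   | _ , _ , _ , src→x , _ , _ , _ =
        Route-⊆ old (fromEnd src∈ (inBlock (here refl) ◅◅ SameBlock-sym (inBlock (there m′)) ◅◅ x~b)) ++ʳ (_ , src→x)

      blockShape′ : ∀ {x} → x ∈ V′ → SameBlock G x start ⊎ SameBlock G x end ⊎ BetweenBridges V′ x
      blockShape′ m with old-or-inner m
      ... | inj₁ m′ = lift (blockShape m′)
        where
        lift : ∀ {x} → SameBlock G x start ⊎ SameBlock G x end ⊎ BetweenBridges (start ∷ stops) x →
               SameBlock G x start ⊎ SameBlock G x end ⊎ BetweenBridges V′ x
        lift = Data.Sum.map₂ (Data.Sum.map₂ (BetweenBridges-⊆ old⊆))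
      ... | inj₂ m′ with inBlock (there m′) | blockShape s∈
      ...   | x~s | inj₁ s~a        = inj₁ (x~s ◅◅ s~a)
      ...   | x~s | inj₂ (inj₁ s~b) = inj₂ (inj₁ (x~s ◅◅ s~b))
      ...   | x~s | inj₂ (inj₂ bb)  = inj₂ (inj₂ (BetweenBridges-⊆ old⊆ (BetweenBridges-resp x~s bb)))

    insertEar : Extension t w
    insertEar = record
      { arcSet = arcSet′ ; start = start ; end = end ; stops = stops′ ; walk = walk′
      ; arcs-on = arcs-on′ ; antisym = antisym′ ; toStart = toStart′ ; fromEnd = fromEnd′
      ; startBridge = Data.Sum.map₂ (BridgeAt-⊆ old⊆) startBridge
      ; endBridge = Data.Sum.map₂ (BridgeAt-⊆ old⊆) endBridge
      ; blockShape = blockShape′ } , old⊆ , there (inner⊆ w∈inner)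

  module EarThrough (t : Tour) {s w} (s∈ : s ∈ vertices t) (w∉ : w ∉ vertices t)
                    (sw : Adj G s w) (¬bridge : ¬ Bridge G s w) where
    private
      erased : Σ (List (Fin n)) λ P → Walk (AdjMinus G s w) w s P × Unique (w ∷ P)
      erased = loopErase _≟ᶠ_ (proj₂ (fromStar (nonBridge⇒detour sw ¬bridge)))

      P : List (Fin n)
      P = proj₁ erased

      w→s : Walk (AdjMinus G s w) w s P
      w→s = proj₁ (proj₂ erased)

      U : Unique (w ∷ P)
      U = proj₂ (proj₂ erased)

      open FirstEntry (firstEntry _≟ᶠ_ (vertices t) w→s w∉ s∈)

      detour : Walk (AdjMinus G s w) w entry (prefix ++ [ entry ])
      detour = outside ∷ʳʷ enter

      U′ : Unique (w ∷ prefix ++ [ entry ])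
      U′ = Unique-++⁻ˡ (w ∷ prefix ++ [ entry ])
             (subst (λ l → Unique (w ∷ l)) (trans P≡ (sym (++-assoc prefix [ entry ] rest))) U)

      detour⊆P : w ∷ prefix ++ [ entry ] ⊆ w ∷ P
      detour⊆P (here e) = here e
      detour⊆P (there m) = there (subst (_ ∈_) (sym P≡) ([ ∈-++⁺ˡ , (λ { (here e) → ∈-++⁺ʳ prefix (here e) }) ]′ (∈-++⁻ prefix m)))

      inBlock : ∀ {z} → z ∈ s ∷ w ∷ prefix ++ [ entry ] → SameBlock G z s
      inBlock (here refl) = ε
      inBlock (there m)   = cycle-inBlock [] sw []ʷ w→s U (detour⊆P m)

      antisym : ∀ {u v} → (u , v) ∈ arcs s (w ∷ prefix ++ [ entry ]) → (v , u) ∈ arcs s (w ∷ prefix ++ [ entry ]) → ⊥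
      antisym (here refl) (here e)  = w∉ (subst (_∈ _) (sym (cong proj₁ e)) s∈)
      antisym (here refl) (there m) = proj₂ (arc-from-head detour U′ m) (inj₂ (refl , refl))
      antisym (there m) (here refl) = proj₂ (arc-from-head detour U′ m) (inj₂ (refl , refl))
      antisym (there m) (there m′)  = Unique⇒arcs-antisym U′ m m′

      fresh : ∀ {u v} → (u , v) ∈ arcs s (w ∷ prefix ++ [ entry ]) → u ∉ vertices t ⊎ v ∉ vertices t
      fresh (here refl) = inj₂ w∉
      fresh (there m)   = inj₁ (outside∉ (arc∈-∷ʳ⇒∈ prefix m))

    earThrough : Ear t s w
    earThrough = record
      { path = sw ∷ʷ mapʷ proj₁ detour ; src∈ = s∈ ; dst∈ = entry∈
      ; inBlock = inBlock ; antisym = antisym ; fresh = fresh ; w∈inner = here refl }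

  addEar : ∀ t {s w} → s ∈ vertices t → w ∉ vertices t → Ear t s w → Extension t w
  addEar t s∈ w∉ ear with visitOrder (Tour.walk t) (Ear.dst∈ ear) (Ear.src∈ ear)
  ... | inj₁ order = InsertEar.insertEar t s∈ ear order
  ... | inj₂ order = InsertEar.insertEar t s∈ (reverseEar w∉ ear) order

  crossFromEndBlock : ∀ t {s w} → s ∈ vertices t → w ∉ vertices t → Bridge G s w →
    SameBlock G s (Tour.start t) ⊎ SameBlock G s (Tour.end t) → Extension t w
  crossFromEndBlock t s∈ w∉ b (inj₂ s~end) = CrossBridge.crossBridge t s∈ w∉ b s~end
  crossFromEndBlock t s∈ w∉ b (inj₁ s~start) =
    let (t′ , ⊆t′ , w∈) = CrossBridge.crossBridge reverseTour (⊆-reverseTour s∈) (w∉ ∘ reverseTour-⊆) b s~start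
    in t′ , ⊆t′ ∘ ⊆-reverseTour , w∈
    where open ReverseTour t

  module _ (Δ≤2 : MaxDegBridgeBlockTree≤2 G) where

    bridge-leaves-endBlock : ∀ t {s w} → s ∈ vertices t → w ∉ vertices t → Bridge G s w →
      SameBlock G s (Tour.start t) ⊎ SameBlock G s (Tour.end t)
    bridge-leaves-endBlock t s∈ w∉ b with Tour.blockShape t s∈
    ... | inj₁ s~start        = inj₁ s~start
    ... | inj₂ (inj₁ s~end)   = inj₂ s~end
    ... | inj₂ (inj₂ (e₁ , e₂ , e₁≢e₂ , in₁ , in₂ , i₁ , i₂)) =
      ⊥-elim (Δ≤2 _ e₁ e₂ (toBr b) e₁≢e₂ (toBr-distinct b w∉ e₁ in₁) (toBr-distinct b w∉ e₂ in₂)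
                  i₁ i₂ (proj₁ (toBr-incident b)))

    extendTour : ∀ t {s w} → s ∈ vertices t → w ∉ vertices t → Adj G s w → Extension t w
    extendTour t {s} {w} s∈ w∉ sw with Bridge? s w
    ... | yes b      = crossFromEndBlock t s∈ w∉ b (bridge-leaves-endBlock t s∈ w∉ b)
    ... | no ¬bridge = addEar t s∈ w∉ (EarThrough.earThrough t s∈ w∉ sw ¬bridge)

    spanningTour : Connected G → Fin n → Σ Tour λ t → ∀ x → x ∈ vertices t
    spanningTour connected u with saturate (Adj G) Adj? vertices extendTour (singletonTour u)
    ... | t , u∈ , closed = t , λ x → Closed-Star (Adj G) Adj? closed (u∈ (here refl)) (connected u x)

module Colouring {n : ℕ} (G : Graph n) (side : Fin n → Bool)
                 (bipartite : ∀ u v → Adj G u v → side u ≢ side v) where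
  open GraphFacts G using (Adj-sym)
  open Tours G
  open Walks

  colour : Bool → Fin 2
  colour false = zero
  colour true  = suc zero

  colour-injective : ∀ {a b} → colour a ≡ colour b → a ≡ b
  colour-injective {false} {false} _ = refl
  colour-injective {true}  {true}  _ = refl

  xor-injectiveˡ : ∀ k {a b} → k xor a ≡ k xor b → a ≡ b
  xor-injectiveˡ false = id
  xor-injectiveˡ true  = not-injective

  module _ (A : Arcs) (antisym : ∀ {u v} → (u , v) ∈ A → (v , u) ∈ A → ⊥) where
    open import Data.List.Membership.DecPropositional (≡-dec (_≟ᶠ_ {n}) (_≟ᶠ_ {n}))
      using () renaming (_∈?_ to _∈ᴬ?_)

    -- Edges outside A lie on none of the paths used below; they get colour zero.
    arcColouring : Fin n → Fin n → Fin 2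
    arcColouring x y with (x , y) ∈ᴬ? A | (y , x) ∈ᴬ? A
    ... | yes _ | _     = colour (side x)
    ... | no _  | yes _ = colour (side y)
    ... | no _  | no _  = zero

    arcColouring-sym : ∀ x y → arcColouring x y ≡ arcColouring y x
    arcColouring-sym x y with (x , y) ∈ᴬ? A | (y , x) ∈ᴬ? A
    ... | yes xy | yes yx = ⊥-elim (antisym xy yx)
    ... | yes _  | no _   = refl
    ... | no _   | yes _  = refl
    ... | no _   | no _   = refl

    arcColouring-arc : ∀ {x y} → (x , y) ∈ A → arcColouring x y ≡ colour (side x)
    arcColouring-arc {x} {y} xy with (x , y) ∈ᴬ? A
    ... | yes _   = refl
    ... | no xy∉  = contradiction xy xy∉

    -- Consecutive k-steps get different colours because their tails lie on different sides.
    Coloured : Bool → Fin n → Fin n → Set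
    Coloured k x y = Adj G x y × arcColouring x y ≡ colour (k xor side x)

    forward : ∀ {x y} → Step A x y → Coloured false x y
    forward (a , xy) = a , arcColouring-arc xy

    backward : ∀ {x y} → Coloured false x y → Coloured true y x
    backward {x} {y} (a , c) =
      Adj-sym a , trans (arcColouring-sym y x) (trans c (cong colour (¬-not (bipartite x y a))))

    isWalk : ∀ k {u v P} → Walk (Coloured k) u v P → IsWalk G (u ∷ P)
    isWalk k []ʷ            = tt
    isWalk k ((a , _) ∷ʷ w) = a , isWalk k w

    properlyColoured : ∀ k {u v P} → Walk (Coloured k) u v P → ProperlyColored arcColouring (u ∷ P)
    properlyColoured k []ʷ        = tt
    properlyColoured k (_ ∷ʷ []ʷ) = tt
    properlyColoured k (_∷ʷ_ {x} {y} (a , cxy) (_∷ʷ_ (b , cyz) w)) =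
      (λ same → bipartite x y a (xor-injectiveˡ k (colour-injective (trans (sym cxy) (trans same cyz))))) ,
      properlyColoured k ((b , cyz) ∷ʷ w)

    properPath : ∀ k {u v P} → Walk (Coloured k) u v P → ProperPath G arcColouring u v
    properPath k {u} w with loopErase _≟ᶠ_ w
    ... | P , path , U = u ∷ P , refl , last≡ path , U , isWalk k path , properlyColoured k path

  spanningTour⇒pc≤2 : (t : Tour) → (∀ x → x ∈ vertices t) → HasPCColoring G 2
  spanningTour⇒pc≤2 t spanning = (arcColouring arcSet antisym , arcColouring-sym arcSet antisym) , connect
    where
    open Tour t
    connect : ∀ x y → x ≢ y → ProperPath G (arcColouring arcSet antisym) x y
    connect x y _ with visitOrder walk (spanning x) (spanning y)
    ... | inj₁ v = properPath arcSet antisym false (mapʷ (forward arcSet antisym) (Visits.between v))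
    ... | inj₂ v = properPath arcSet antisym true
                     (Reversal.walk (reverseʷ (backward arcSet antisym) (mapʷ (forward arcSet antisym) (Visits.between v))))

module LowerBound {n : ℕ} (G : Graph n) where
  open GraphFacts G using (Adj?)

  private
    adjacentIfDistinct? : ∀ u v → Dec (u ≢ v → Adj G u v)
    adjacentIfDistinct? u v = ¬? (u ≟ᶠ v) →-dec Adj? u v

  nonAdjacentPair : ¬ Complete G → Σ (Fin n) λ u → Σ (Fin n) λ v → u ≢ v × ¬ Adj G u v
  nonAdjacentPair ¬complete with ¬∀⟶∃¬ n _ (λ u → all? (adjacentIfDistinct? u)) ¬complete
  ... | u , ¬allAdj with ¬∀⟶∃¬ n _ (adjacentIfDistinct? u) ¬allAdj
  ...   | v , ¬adj = u , v , (λ u≡v → ¬adj (λ u≢v → contradiction u≡v u≢v)) , (λ uv → ¬adj (λ _ → uv))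

  -- With one colour a proper path has at most one edge.
  monochromatic-noPath : (c : Fin n → Fin n → Fin 1) → ∀ {u v} → u ≢ v → ¬ Adj G u v → ¬ ProperPath G c u v
  monochromatic-noPath c u≢v ¬uv ([] , () , _)
  monochromatic-noPath c u≢v ¬uv (x ∷ [] , first , last , _) =
    u≢v (trans (sym (just-injective first)) (just-injective last))
  monochromatic-noPath c u≢v ¬uv (x ∷ y ∷ [] , first , last , _ , (xy , _) , _) =
    ¬uv (subst₂ (Adj G) (just-injective first) (just-injective last) xy)
  monochromatic-noPath c u≢v ¬uv (x ∷ y ∷ z ∷ _ , _ , _ , _ , _ , (different , _)) with c x y | c y z
  ... | zero | zero = different refl

  pc≥2 : ∀ {u v} → u ≢ v → ¬ Adj G u v → ∀ m → m < 2 → ¬ HasPCColoring G m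
  pc≥2 {u} _ _ zero _ ((c , _) , _) with c u u
  ... | ()
  pc≥2 u≢v ¬uv (suc zero) _ ((c , _) , connect) = monochromatic-noPath c u≢v ¬uv (connect _ _ u≢v)
  pc≥2 _ _ (suc (suc _)) (s≤s (s≤s ()))

open Tours using (spanningTour)
open Colouring using (spanningTour⇒pc≤2)
open LowerBound using (nonAdjacentPair; pc≥2)

corollary2p1 : ∀ {n : ℕ} (G : Graph n) → Connected G → Bipartite G → ¬ Complete G →
    MaxDegBridgeBlockTree≤2 G → PCNumberIs G 2
corollary2p1 G connected (side , bipartite) ¬complete Δ≤2 with nonAdjacentPair G ¬complete
... | u , v , u≢v , ¬uv with spanningTour G Δ≤2 connected u
... | t , spanning = spanningTour⇒pc≤2 G side bipartite t spanning , pc≥2 G u≢v ¬uv
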